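{- Let $\alpha\geq 3$ and $\mathbf{a}=(\alpha,\alpha,1)$. If $G(\alpha,\alpha)$ is Hamilton-laceable and $G(\alpha,\alpha-1,1)$ is Hamilton-1-laceable, then $G(\mathbf{a})\in\mathcal{L}_{12}$.
   Context: For $\mathbf{a}=(a_1,\ldots,a_k)$ with $a_1\geq\cdots\geq a_k\geq 1$ and $n=\sum a_i$, $G(\mathbf{a})$ is the graph on all strings of length $n$ over $\{1,\ldots,k\}$ with exactly $a_i$ occurrences of symbol $i$, two strings adjacent if one arises from the other by swapping the first entry with an entry at some position $2,\ldots,n$ distinct from the first entry. $G(\alpha,\alpha)$ is bipartite with classes given by the first symbol; Hamilton-laceable means any two vertices from different classes are joined by a Hamilton path. Hamilton-1-laceable: there is a Hamilton path between any vertex with first symbol $1$ and any vertex with first symbol different from $1$. For $\ell\in\{3,4\}$, $s\in\{1,2\}$, $t\in\{1,2,\ell\}$ put $p_\ell(s,t):=\ell$ if $t\in\{s,\ell\}$ and $p_\ell(s,t):=t$ otherwise, and $q_\ell(s,t):=s$. $G(\mathbf{a})\in\mathcal{L}_{12}$ means: for every $\ell\in\{3,4\}$, every vertex $x$ with first symbol $s\in\{1,2\}$ and every vertex $y\neq x$ with first symbol $t\in\{1,2,\ell\}$ for which some position $\hat{i}>1$ has $(x_{\hat{i}},y_{\hat{i}})=(p_\ell(s,t),q_\ell(s,t))$, there is a Hamilton path between $x$ and $y$. -}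

module Defs where

open import Data.Nat using (ℕ; zero; suc; _≤_; _≟_; _≡ᵇ_)
open import Data.Bool using (if_then_else_; _∨_)
open import Data.Fin using (Fin; toℕ)
open import Data.List using (List; []; _∷_; _++_; length; lookup; filter; drop; head)
open import Data.List.Relation.Unary.All using (All)
open import Data.List.Relation.Unary.Linked using (Linked)
open import Data.List.Relation.Unary.Unique.Propositional using (Unique)
open import Data.List.Membership.Propositional using (_∈_)
open import Data.Maybe using (just)
open import Data.Product using (Σ; ∃; _×_)
open import Data.Sum using (_⊎_)
open import Data.Empty using (⊥)
open import Relation.Binary.PropositionalEquality using (_≡_; _≢_)

-- Strings over the symbols {1,…,k}, encoded 1-based as natural numbers.
Word : Set
Word = List ℕ

Vertex : List ℕ → Word → Set
Vertex a x =
  All (λ c → 1 ≤ c × c ≤ length a) x ×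
  ((i : Fin (length a)) → length (filter (_≟ suc (toℕ i)) x) ≡ lookup a i)

Adj : Word → Word → Set
Adj x y = Σ ℕ λ c → Σ ℕ λ d → Σ Word λ u → Σ Word λ w →
  c ≢ d × x ≡ c ∷ (u ++ d ∷ w) × y ≡ d ∷ (u ++ c ∷ w)

HamPath : List ℕ → Word → Word → Set
HamPath a x y = Σ (List Word) λ mid →
  Linked Adj (x ∷ (mid ++ y ∷ [])) ×
  Unique (x ∷ (mid ++ y ∷ [])) ×
  All (Vertex a) (x ∷ (mid ++ y ∷ [])) ×
  ((z : Word) → Vertex a z → z ∈ (x ∷ (mid ++ y ∷ [])))

First : Word → ℕ → Set
First [] s = ⊥
First (c ∷ _) s = c ≡ s

-- Symbol at 0-based index i (i.e. at 1-based position i+1).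
SymAt : Word → ℕ → ℕ → Set
SymAt x i c = head (drop i x) ≡ just c

-- Hamilton-laceable (for the bipartite G(α,α), classes = first symbol).
HamLaceable : List ℕ → Set
HamLaceable a = (x y : Word) (s t : ℕ) → Vertex a x → Vertex a y →
  First x s → First y t → s ≢ t → HamPath a x y

Ham1Laceable : List ℕ → Set
Ham1Laceable a = (x y : Word) (t : ℕ) → Vertex a x → Vertex a y →
  First x 1 → First y t → t ≢ 1 → HamPath a x y

pℓ : ℕ → ℕ → ℕ → ℕ
pℓ ℓ s t = if (t ≡ᵇ s) ∨ (t ≡ᵇ ℓ) then ℓ else t

qℓ : ℕ → ℕ → ℕ → ℕ
qℓ ℓ s t = s

InL12 : List ℕ → Set
InL12 a = (ℓ : ℕ) → (ℓ ≡ 3 ⊎ ℓ ≡ 4) →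
  (x y : Word) (s t : ℕ) → Vertex a x → Vertex a y → y ≢ x →
  First x s → (s ≡ 1 ⊎ s ≡ 2) →
  First y t → (t ≡ 1 ⊎ t ≡ 2 ⊎ t ≡ ℓ) →
  (Σ ℕ λ i → 1 ≤ i × SymAt x i (pℓ ℓ s t) × SymAt y i (qℓ ℓ s t)) →
  HamPath a x y

{-# OPTIONS --safe #-}
module Submission where

-- Split the vertices of G(α,α,1) according to their symbol at the witness position (0-based
-- index î ≥ 1), where x carries p_ℓ(s,t) and y carries s. Deleting that position identifies the
-- slice with symbol 3 with G(α,α), the slice with symbol 2 with G(α,α-1,1), and the slice with
-- symbol 1 with G(α,α-1,1) after exchanging the symbols 1 and 2 (σ below); as the first position
-- is untouched, these identifications respect edges and first symbols. Since no symbol exceeds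
-- 3, either p_ℓ(s,t) = 3 and t ≠ σ s, or p_ℓ(s,t) = t = σ s, and x, y lie in different slices.
-- The Hamilton path runs through the slice of x, the remaining slice and the slice of y; it
-- leaves slice P for slice M along the edge from a vertex with symbol P at î and first symbol M
-- to the vertex with these two symbols swapped, and the laceability hypotheses, applied in each
-- slice, join the resulting endpoints.

open import Defs
open import Data.Nat using (ℕ; zero; suc; _≤_; _<_; _+_; _∸_; z≤n; s≤s; _≟_; _≡ᵇ_)
open import Data.Nat.Properties using (suc-injective; +-suc; +-comm; ≤-trans; ≤-pred; n≤1+n)
open import Data.Bool using (true; false; if_then_else_)
open import Function.Bundles using (_⇔_; mk⇔)
open import Relation.Nullary.Decidable using (does-⇔)
open import Data.Fin using (zero; suc)
open import Data.List using (List; []; _∷_; _++_; length; filter; map; reverse; replicate)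
open import Data.List.Properties using (map-++; map-injective; ++-assoc; unfold-reverse; reverse-++; ∷-injective)
open import Data.List.Relation.Unary.All as All using (All; []; _∷_)
import Data.List.Relation.Unary.All.Properties as All
open import Data.List.Relation.Unary.Linked as Linked using (Linked; []; [-]; _∷_)
import Data.List.Relation.Unary.Linked.Properties as Linked
open import Data.List.Relation.Unary.Unique.Propositional using (Unique)
import Data.List.Relation.Unary.Unique.Propositional.Properties as Unique
open import Data.List.Relation.Binary.Permutation.Propositional using (↭-sym; ↭⇒↭ₛ)
open import Data.List.Relation.Binary.Permutation.Propositional.Properties using (↭-reverse; All-resp-↭; ∈-resp-↭)
open import Data.List.Membership.Propositional using (_∈_)
open import Data.List.Membership.Propositional.Properties using (∈-map⁺; ∈-++⁺ˡ; ∈-++⁺ʳ)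
open import Data.Maybe.Properties using (just-injective)
open import Data.Product using (Σ; ∃; _×_; _,_; proj₁; proj₂)
open import Data.Sum using (_⊎_; inj₁; inj₂; [_,_]; [_,_]′)
open import Data.Empty using (⊥)
open import Function using (flip; _∘_)
open import Level using (0ℓ)
open import Relation.Unary using (Pred; _⊆_; _∪_)
open import Relation.Binary.PropositionalEquality using (_≡_; _≢_; ≢-sym; refl; sym; trans; cong; cong₂; subst; subst₂; setoid)
open import Data.List.Relation.Binary.Permutation.Setoid.Properties (setoid Word) using (Unique-resp-↭)

count : ℕ → Word → ℕ
count d [] = 0
count d (c ∷ w) = if c ≡ᵇ d then suc (count d w) else count d w

length-filter≡count : ∀ d w → length (filter (_≟ d) w) ≡ count d w
length-filter≡count d [] = refl
length-filter≡count d (c ∷ w) with c ≡ᵇ d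
... | true = cong suc (length-filter≡count d w)
... | false = length-filter≡count d w

count-swap : ∀ d a b w → count d (a ∷ b ∷ w) ≡ count d (b ∷ a ∷ w)
count-swap d a b w with a ≡ᵇ d | b ≡ᵇ d
... | true  | true  = refl
... | true  | false = refl
... | false | true  = refl
... | false | false = refl

count-map : ∀ {f : ℕ → ℕ} {d e} → (∀ {c} → f c ≡ d ⇔ c ≡ e) → ∀ w → count d (map f w) ≡ count e w
count-map f⇔ [] = refl
count-map {f} {d} {e} f⇔ (c ∷ w) =
  cong₂ (λ b n → if b then suc n else n) (does-⇔ f⇔ (f c ≟ d) (c ≟ e)) (count-map f⇔ w)

insertAt : ℕ → ℕ → Word → Word
insertAt zero c w = c ∷ w
insertAt (suc i) c [] = c ∷ []
insertAt (suc i) c (h ∷ w) = h ∷ insertAt i c w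

removeAt : ℕ → Word → Word
removeAt i [] = []
removeAt zero (h ∷ w) = w
removeAt (suc i) (h ∷ w) = h ∷ removeAt i w

length-insertAt : ∀ i c w → length (insertAt i c w) ≡ suc (length w)
length-insertAt zero c w = refl
length-insertAt (suc i) c [] = refl
length-insertAt (suc i) c (h ∷ w) = cong suc (length-insertAt i c w)

insertAt-injective : ∀ i c {w w′} → insertAt i c w ≡ insertAt i c w′ → w ≡ w′
insertAt-injective zero c refl = refl
insertAt-injective (suc i) c {[]} {[]} _ = refl
insertAt-injective (suc i) c {[]} {h ∷ w′} eq with trans (suc-injective (cong length eq)) (length-insertAt i c w′)
... | ()
insertAt-injective (suc i) c {h ∷ w} {[]} eq with trans (suc-injective (cong length (sym eq))) (length-insertAt i c w)
... | ()
insertAt-injective (suc i) c {h ∷ w} {h′ ∷ w′} eq with ∷-injective eq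
... | refl , eq′ = cong (h ∷_) (insertAt-injective i c eq′)

insertAt-removeAt : ∀ i {c} z → SymAt z i c → insertAt i c (removeAt i z) ≡ z
insertAt-removeAt zero (h ∷ w) refl = refl
insertAt-removeAt (suc i) (h ∷ w) s = cong (h ∷_) (insertAt-removeAt i w s)

count-insertAt : ∀ d i c w → count d (insertAt i c w) ≡ count d (c ∷ w)
count-insertAt d zero c w = refl
count-insertAt d (suc i) c [] = refl
count-insertAt d (suc i) c (h ∷ w) =
  trans (cong (λ n → if h ≡ᵇ d then suc n else n) (count-insertAt d i c w)) (count-swap d h c w)

module _ {P : ℕ → Set} where

  All-insertAt⁺ : ∀ i {c} w → All P (c ∷ w) → All P (insertAt i c w)
  All-insertAt⁺ zero w ps = ps
  All-insertAt⁺ (suc i) [] ps = ps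
  All-insertAt⁺ (suc i) (h ∷ w) (pc ∷ ph ∷ ps) = ph ∷ All-insertAt⁺ i w (pc ∷ ps)

  All-insertAt⁻ : ∀ i {c} w → All P (insertAt i c w) → All P (c ∷ w)
  All-insertAt⁻ zero w ps = ps
  All-insertAt⁻ (suc i) [] ps = ps
  All-insertAt⁻ (suc i) (h ∷ w) (ph ∷ ps) with All-insertAt⁻ i w ps
  ... | pc ∷ ps′ = pc ∷ ph ∷ ps′

  All-SymAt : ∀ i {c} z → All P z → SymAt z i c → P c
  All-SymAt zero (h ∷ z) (ph ∷ _) refl = ph
  All-SymAt (suc i) (h ∷ z) (_ ∷ ps) s = All-SymAt i z ps s

SymAt-insertAt : ∀ i c w → i ≤ length w → SymAt (insertAt i c w) i c
SymAt-insertAt zero c w _ = refl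
SymAt-insertAt (suc i) c (h ∷ w) (s≤s i≤n) = SymAt-insertAt i c w i≤n

SymAt-functional : ∀ i z {c d} → SymAt z i c → SymAt z i d → c ≡ d
SymAt-functional i z s s′ = just-injective (trans (sym s) s′)

SymAt-defined : ∀ i z → i < length z → ∃ (SymAt z i)
SymAt-defined zero (h ∷ z) _ = h , refl
SymAt-defined (suc i) (h ∷ z) (s≤s i<n) = SymAt-defined i z i<n

SymAt⇒<length : ∀ i {c} z → SymAt z i c → i < length z
SymAt⇒<length zero (h ∷ z) _ = s≤s z≤n
SymAt⇒<length (suc i) (h ∷ z) s = s≤s (SymAt⇒<length i z s)

First-map : ∀ f {z s} → First z s → First (map f z) (f s)
First-map f {_ ∷ _} refl = refl

First-removeAt : ∀ i {z s} → First z s → First (removeAt (suc i) z) s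
First-removeAt i {_ ∷ _} f = f

All-First : ∀ {P : ℕ → Set} {z s} → All P z → First z s → P s
All-First (p ∷ _) refl = p

Adj-sym : ∀ {x y} → Adj x y → Adj y x
Adj-sym (c , d , u , w , c≢d , refl , refl) = d , c , u , w , c≢d ∘ sym , refl , refl

Adj-map : ∀ {f : ℕ → ℕ} → (∀ {c d} → f c ≡ f d → c ≡ d) → ∀ {x y} → Adj x y → Adj (map f x) (map f y)
Adj-map {f} f-inj (c , d , u , w , c≢d , refl , refl) =
  f c , f d , map f u , map f w , c≢d ∘ f-inj ,
  cong (f c ∷_) (map-++ f u (d ∷ w)) , cong (f d ∷_) (map-++ f u (c ∷ w))

insertAt-++ : ∀ i c u w → Σ Word λ u′ → Σ Word λ w′ → ∀ e → insertAt i c (u ++ e ∷ w) ≡ u′ ++ e ∷ w′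
insertAt-++ zero c u w = c ∷ u , w , λ _ → refl
insertAt-++ (suc i) c [] w = [] , insertAt i c w , λ _ → refl
insertAt-++ (suc i) c (h ∷ u) w with insertAt-++ i c u w
... | u′ , w′ , eq = h ∷ u′ , w′ , cong (h ∷_) ∘ eq

insertAt-split : ∀ i w → Σ Word λ u → Σ Word λ v → ∀ e → insertAt i e w ≡ u ++ e ∷ v
insertAt-split zero w = [] , w , λ _ → refl
insertAt-split (suc i) [] = [] , [] , λ _ → refl
insertAt-split (suc i) (h ∷ w) with insertAt-split i w
... | u , v , eq = h ∷ u , v , cong (h ∷_) ∘ eq

Adj-insertAt : ∀ i c {x y} → Adj x y → Adj (insertAt (suc i) c x) (insertAt (suc i) c y)
Adj-insertAt i c (a , b , u , w , a≢b , refl , refl) with insertAt-++ i c u w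
... | u′ , w′ , eq = a , b , u′ , w′ , a≢b , cong (a ∷_) (eq b) , cong (b ∷_) (eq a)

Adj-swap : ∀ i {c d} w → c ≢ d → Adj (c ∷ insertAt i d w) (d ∷ insertAt i c w)
Adj-swap i {c} {d} w c≢d with insertAt-split i w
... | u , v , eq = c , d , u , v , c≢d , cong (c ∷_) (eq d) , cong (d ∷_) (eq c)

-- Hamilton paths of induced subgraphs

Linked-join : ∀ {R : Word → Word → Set} xs {u v ys} → Linked R (xs ++ u ∷ []) → R u v → Linked R (v ∷ ys) →
  Linked R ((xs ++ u ∷ []) ++ v ∷ ys)
Linked-join [] _ r l = r ∷ l
Linked-join (x ∷ []) (r₀ ∷ [-]) r l = r₀ ∷ r ∷ l
Linked-join (x ∷ x′ ∷ xs) (r₀ ∷ l₀) r l = r₀ ∷ Linked-join (x′ ∷ xs) l₀ r l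

Linked-reverse : ∀ {R : Word → Word → Set} {xs} → Linked R xs → Linked (flip R) (reverse xs)
Linked-reverse [] = []
Linked-reverse [-] = [-]
Linked-reverse {R} {x ∷ y ∷ ys} (r ∷ l) =
  subst (Linked (flip R)) (sym (trans (unfold-reverse x (y ∷ ys)) (cong (_++ x ∷ []) (unfold-reverse y ys))))
    (Linked-join (reverse ys) (subst (Linked (flip R)) (unfold-reverse y ys) (Linked-reverse l)) r [-])

-- HamPath a is HamPathOn (Vertex a) by definition.
HamPathOn : Pred Word 0ℓ → Word → Word → Set
HamPathOn V x y = Σ (List Word) λ mid →
  Linked Adj (x ∷ (mid ++ y ∷ [])) ×
  Unique (x ∷ (mid ++ y ∷ [])) ×
  All V (x ∷ (mid ++ y ∷ [])) ×
  ((z : Word) → V z → z ∈ (x ∷ (mid ++ y ∷ [])))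

HamPathOn-resp : ∀ {V W x y} → V ⊆ W → W ⊆ V → HamPathOn V x y → HamPathOn W x y
HamPathOn-resp V⊆W W⊆V (mid , l , u , vs , cover) = mid , l , u , All.map V⊆W vs , λ z → cover z ∘ W⊆V

HamPathOn-reverse : ∀ {V x y} → HamPathOn V x y → HamPathOn V y x
HamPathOn-reverse {V} {x} {y} (mid , l , u , vs , cover) =
  reverse mid ,
  subst (Linked Adj) eq (Linked.map Adj-sym (Linked-reverse l)) ,
  subst Unique eq (Unique-resp-↭ (↭⇒↭ₛ (↭-sym (↭-reverse L))) u) ,
  subst (All V) eq (All-resp-↭ (↭-sym (↭-reverse L)) vs) ,
  λ z v → subst (z ∈_) eq (∈-resp-↭ (↭-sym (↭-reverse L)) (cover z v))
  where
  L : List Word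
  L = x ∷ (mid ++ y ∷ [])
  eq : reverse L ≡ y ∷ (reverse mid ++ x ∷ [])
  eq = trans (unfold-reverse x (mid ++ y ∷ [])) (cong (_++ x ∷ []) (reverse-++ mid (y ∷ [])))

HamPathOn-++ : ∀ {V W x u v y} → (∀ {z} → V z → W z → ⊥) →
  HamPathOn V x u → Adj u v → HamPathOn W v y → HamPathOn (V ∪ W) x y
HamPathOn-++ {V} {W} {x} {u} {v} {y} V⊥W (m₁ , l₁ , u₁ , vs₁ , cover₁) u~v (m₂ , l₂ , u₂ , vs₂ , cover₂) =
  m₁ ++ u ∷ v ∷ m₂ ,
  subst (Linked Adj) eq (Linked-join (x ∷ m₁) l₁ u~v l₂) ,
  subst Unique eq (Unique.++⁺ u₁ u₂ λ (p , q) → V⊥W (All.lookup vs₁ p) (All.lookup vs₂ q)) ,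
  subst (All (V ∪ W)) eq (All.++⁺ (All.map inj₁ vs₁) (All.map inj₂ vs₂)) ,
  λ z → subst (z ∈_) eq ∘ [ ∈-++⁺ˡ ∘ cover₁ z , ∈-++⁺ʳ L₁ ∘ cover₂ z ]
  where
  L₁ : List Word
  L₁ = x ∷ (m₁ ++ u ∷ [])
  eq : L₁ ++ v ∷ (m₂ ++ y ∷ []) ≡ x ∷ ((m₁ ++ u ∷ v ∷ m₂) ++ y ∷ [])
  eq = cong (x ∷_) (trans (++-assoc m₁ (u ∷ []) _) (sym (++-assoc m₁ (u ∷ v ∷ m₂) (y ∷ []))))

record BijectiveHom (V W : Pred Word 0ℓ) : Set where
  field
    to           : Word → Word
    from         : Word → Word
    to-Adj       : ∀ {x y} → Adj x y → Adj (to x) (to y)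
    to-injective : ∀ {x y} → to x ≡ to y → x ≡ y
    to-∈         : ∀ {w} → V w → W (to w)
    from-∈       : ∀ {z} → W z → V (from z)
    to-from      : ∀ {z} → W z → to (from z) ≡ z

module _ {V W : Pred Word 0ℓ} (φ : BijectiveHom V W) where
  open BijectiveHom φ

  HamPathOn-map : ∀ {x y} → HamPathOn V x y → HamPathOn W (to x) (to y)
  HamPathOn-map {x} {y} (mid , l , u , vs , cover) =
    map to mid ,
    subst (Linked Adj) eq (Linked.map⁺ (Linked.map to-Adj l)) ,
    subst Unique eq (Unique.map⁺ to-injective u) ,
    subst (All W) eq (All.map⁺ (All.map to-∈ vs)) ,
    λ z w → subst (_∈ _) (to-from w) (subst (to (from z) ∈_) eq (∈-map⁺ to (cover (from z) (from-∈ w))))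
    where
    eq : map to (x ∷ (mid ++ y ∷ [])) ≡ to x ∷ (map to mid ++ to y ∷ [])
    eq = cong (to x ∷_) (map-++ to mid (y ∷ []))

  HamPathOn-lift : ∀ {x y} → W x → W y → HamPathOn V (from x) (from y) → HamPathOn W x y
  HamPathOn-lift wx wy = subst₂ (HamPathOn W) (to-from wx) (to-from wy) ∘ HamPathOn-map

Letter : ℕ → Set
Letter c = 1 ≤ c × c ≤ 3

pattern letter₁ = s≤s z≤n , s≤s z≤n
pattern letter₂ = s≤s z≤n , s≤s (s≤s z≤n)
pattern letter₃ = s≤s z≤n , s≤s (s≤s (s≤s z≤n))

Counts : ℕ → ℕ → ℕ → Word → Set
Counts a b c w = All Letter w × count 1 w ≡ a × count 2 w ≡ b × count 3 w ≡ c

module _ {a b c : ℕ} {w : Word} where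

  Vertex₃⇒Counts : Vertex (a ∷ b ∷ c ∷ []) w → Counts a b c w
  Vertex₃⇒Counts (ls , n) =
    ls , trans (sym (length-filter≡count 1 w)) (n zero) , trans (sym (length-filter≡count 2 w)) (n (suc zero)) ,
    trans (sym (length-filter≡count 3 w)) (n (suc (suc zero)))

  Counts⇒Vertex₃ : Counts a b c w → Vertex (a ∷ b ∷ c ∷ []) w
  Counts⇒Vertex₃ (ls , e₁ , e₂ , e₃) = ls , λ where
    zero → trans (length-filter≡count 1 w) e₁
    (suc zero) → trans (length-filter≡count 2 w) e₂
    (suc (suc zero)) → trans (length-filter≡count 3 w) e₃

Letter₂ : ℕ → Set
Letter₂ c = 1 ≤ c × c ≤ 2

All-Letter₂⇒count₃≡0 : ∀ {w} → All Letter₂ w → count 3 w ≡ 0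
All-Letter₂⇒count₃≡0 [] = refl
All-Letter₂⇒count₃≡0 ((s≤s z≤n , s≤s z≤n) ∷ ls) = All-Letter₂⇒count₃≡0 ls
All-Letter₂⇒count₃≡0 ((s≤s z≤n , s≤s (s≤s z≤n)) ∷ ls) = All-Letter₂⇒count₃≡0 ls

count₃≡0⇒All-Letter₂ : ∀ {w} → All Letter w → count 3 w ≡ 0 → All Letter₂ w
count₃≡0⇒All-Letter₂ [] _ = []
count₃≡0⇒All-Letter₂ (letter₁ ∷ ls) e = (s≤s z≤n , s≤s z≤n) ∷ count₃≡0⇒All-Letter₂ ls e
count₃≡0⇒All-Letter₂ (letter₂ ∷ ls) e = (s≤s z≤n , s≤s (s≤s z≤n)) ∷ count₃≡0⇒All-Letter₂ ls e
count₃≡0⇒All-Letter₂ (letter₃ ∷ ls) ()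

module _ {a b : ℕ} {w : Word} where

  Vertex₂⇒Counts : Vertex (a ∷ b ∷ []) w → Counts a b 0 w
  Vertex₂⇒Counts (ls , n) =
    All.map (λ (1≤c , c≤2) → 1≤c , ≤-trans c≤2 (n≤1+n 2)) ls ,
    trans (sym (length-filter≡count 1 w)) (n zero) , trans (sym (length-filter≡count 2 w)) (n (suc zero)) ,
    All-Letter₂⇒count₃≡0 ls

  Counts⇒Vertex₂ : Counts a b 0 w → Vertex (a ∷ b ∷ []) w
  Counts⇒Vertex₂ (ls , e₁ , e₂ , e₃) = count₃≡0⇒All-Letter₂ ls e₃ , λ where
    zero → trans (length-filter≡count 1 w) e₁
    (suc zero) → trans (length-filter≡count 2 w) e₂

module _ {a b c : ℕ} {w : Word} where

  Counts-∷₁ : Counts a b c w → Counts (suc a) b c (1 ∷ w)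
  Counts-∷₁ (ls , e₁ , e₂ , e₃) = letter₁ ∷ ls , cong suc e₁ , e₂ , e₃

  Counts-∷₂ : Counts a b c w → Counts a (suc b) c (2 ∷ w)
  Counts-∷₂ (ls , e₁ , e₂ , e₃) = letter₂ ∷ ls , e₁ , cong suc e₂ , e₃

  Counts-∷₃ : Counts a b c w → Counts a b (suc c) (3 ∷ w)
  Counts-∷₃ (ls , e₁ , e₂ , e₃) = letter₃ ∷ ls , e₁ , e₂ , cong suc e₃

  Counts-∷₁⁻ : Counts (suc a) b c (1 ∷ w) → Counts a b c w
  Counts-∷₁⁻ (_ ∷ ls , e₁ , e₂ , e₃) = ls , suc-injective e₁ , e₂ , e₃

  Counts-∷₂⁻ : Counts a (suc b) c (2 ∷ w) → Counts a b c w
  Counts-∷₂⁻ (_ ∷ ls , e₁ , e₂ , e₃) = ls , e₁ , suc-injective e₂ , e₃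

  Counts-∷₃⁻ : Counts a b (suc c) (3 ∷ w) → Counts a b c w
  Counts-∷₃⁻ (_ ∷ ls , e₁ , e₂ , e₃) = ls , e₁ , e₂ , suc-injective e₃

blocks : ℕ → ℕ → ℕ → Word
blocks a b c = replicate a 1 ++ replicate b 2 ++ replicate c 3

Counts-blocks : ∀ a b c → Counts a b c (blocks a b c)
Counts-blocks (suc a) b c = Counts-∷₁ (Counts-blocks a b c)
Counts-blocks zero (suc b) c = Counts-∷₂ (Counts-blocks zero b c)
Counts-blocks zero zero (suc c) = Counts-∷₃ (Counts-blocks zero zero c)
Counts-blocks zero zero zero = [] , refl , refl , refl

length≡count₁₂₃ : ∀ {w} → All Letter w → length w ≡ count 1 w + count 2 w + count 3 w
length≡count₁₂₃ [] = refl
length≡count₁₂₃ (letter₁ ∷ ls) = cong suc (length≡count₁₂₃ ls)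
length≡count₁₂₃ {_ ∷ w} (letter₂ ∷ ls) =
  trans (cong suc (length≡count₁₂₃ ls)) (cong (_+ count 3 w) (sym (+-suc (count 1 w) (count 2 w))))
length≡count₁₂₃ {_ ∷ w} (letter₃ ∷ ls) =
  trans (cong suc (length≡count₁₂₃ ls)) (sym (+-suc (count 1 w + count 2 w) (count 3 w)))

length-Counts : ∀ {a b c w} → Counts a b c w → length w ≡ a + b + c
length-Counts (ls , refl , refl , refl) = length≡count₁₂₃ ls

length-Vertex : ∀ {α x} → Vertex (α ∷ α ∷ 1 ∷ []) x → length x ≡ suc (α + α)
length-Vertex {α} vx = trans (length-Counts (Vertex₃⇒Counts vx)) (+-comm (α + α) 1)

module _ {a b c : ℕ} where

  Counts-insertAt : ∀ i {e} w → Counts a b c (e ∷ w) → Counts a b c (insertAt i e w)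
  Counts-insertAt i {e} w (ls , e₁ , e₂ , e₃) =
    All-insertAt⁺ i w ls ,
    trans (count-insertAt 1 i e w) e₁ , trans (count-insertAt 2 i e w) e₂ , trans (count-insertAt 3 i e w) e₃

  Counts-removeAt : ∀ i {e} z → SymAt z i e → Counts a b c z → Counts a b c (e ∷ removeAt i z)
  Counts-removeAt i {e} z s cz with subst (Counts a b c) (sym (insertAt-removeAt i z s)) cz
  ... | ls , e₁ , e₂ , e₃ =
    All-insertAt⁻ i (removeAt i z) ls ,
    trans (sym (count-insertAt 1 i e _)) e₁ , trans (sym (count-insertAt 2 i e _)) e₂ ,
    trans (sym (count-insertAt 3 i e _)) e₃

σ : ℕ → ℕ
σ 1 = 2
σ 2 = 1
σ c = c

σ-involutive : ∀ c → σ (σ c) ≡ c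
σ-involutive 0 = refl
σ-involutive 1 = refl
σ-involutive 2 = refl
σ-involutive (suc (suc (suc c))) = refl

σ-injective : ∀ {c d} → σ c ≡ σ d → c ≡ d
σ-injective {c} {d} eq = trans (sym (σ-involutive c)) (trans (cong σ eq) (σ-involutive d))

map-σ-involutive : ∀ w → map σ (map σ w) ≡ w
map-σ-involutive [] = refl
map-σ-involutive (c ∷ w) = cong₂ _∷_ (σ-involutive c) (map-σ-involutive w)

σ-Letter : ∀ {c} → Letter c → Letter (σ c)
σ-Letter letter₁ = letter₂
σ-Letter letter₂ = letter₁
σ-Letter letter₃ = letter₃

Counts-map-σ : ∀ {a b c w} → Counts a b c w → Counts b a c (map σ w)
Counts-map-σ {w = w} (ls , e₁ , e₂ , e₃) =
  All.map⁺ (All.map σ-Letter ls) ,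
  trans (count-map σ⇔ w) e₂ , trans (count-map σ⇔ w) e₁ , trans (count-map σ⇔ w) e₃
  where
  σ⇔ : ∀ {c d} → σ c ≡ d ⇔ c ≡ σ d
  σ⇔ {c} {d} = mk⇔ (λ { refl → sym (σ-involutive c) }) (λ { refl → σ-involutive d })

-- Slices of G(α,α,1) by the symbol at a fixed position

index-bound : ∀ {α i c x} → Vertex (α ∷ α ∷ 1 ∷ []) x → SymAt x i c → i ≤ α + α
index-bound {i = i} {x = x} vx s = ≤-pred (subst (i <_) (length-Vertex vx) (SymAt⇒<length i x s))

pℓ-cases : ∀ {ℓ s t} → ℓ ≡ 3 ⊎ ℓ ≡ 4 → s ≡ 1 ⊎ s ≡ 2 → t ≡ 1 ⊎ t ≡ 2 ⊎ t ≡ ℓ →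
  Letter (pℓ ℓ s t) → Letter t → pℓ ℓ s t ≡ 3 × t ≢ σ s ⊎ pℓ ℓ s t ≡ σ s × t ≡ σ s
pℓ-cases (inj₁ refl) (inj₁ refl) (inj₁ refl)        _ _ = inj₁ (refl , λ ())
pℓ-cases (inj₁ refl) (inj₁ refl) (inj₂ (inj₁ refl)) _ _ = inj₂ (refl , refl)
pℓ-cases (inj₁ refl) (inj₁ refl) (inj₂ (inj₂ refl)) _ _ = inj₁ (refl , λ ())
pℓ-cases (inj₁ refl) (inj₂ refl) (inj₁ refl)        _ _ = inj₂ (refl , refl)
pℓ-cases (inj₁ refl) (inj₂ refl) (inj₂ (inj₁ refl)) _ _ = inj₁ (refl , λ ())
pℓ-cases (inj₁ refl) (inj₂ refl) (inj₂ (inj₂ refl)) _ _ = inj₁ (refl , λ ())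
pℓ-cases (inj₂ refl) _           (inj₂ (inj₂ refl)) _ (_ , s≤s (s≤s (s≤s ())))
pℓ-cases (inj₂ refl) (inj₁ refl) (inj₁ refl)        (_ , s≤s (s≤s (s≤s ()))) _
pℓ-cases (inj₂ refl) (inj₁ refl) (inj₂ (inj₁ refl)) _ _ = inj₂ (refl , refl)
pℓ-cases (inj₂ refl) (inj₂ refl) (inj₁ refl)        _ _ = inj₂ (refl , refl)
pℓ-cases (inj₂ refl) (inj₂ refl) (inj₂ (inj₁ refl)) (_ , s≤s (s≤s (s≤s ()))) _

-- α = β + 1, so that α ∸ 1 reduces to β; the witness position is î = j + 1.
module Slicing (β j : ℕ) (î≤ : suc j ≤ suc β + suc β) where

  α : ℕ
  α = suc β

  î : ℕ
  î = suc j

  G : List ℕ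
  G = α ∷ α ∷ 1 ∷ []

  Slice : ℕ → Pred Word 0ℓ
  Slice c z = Vertex G z × SymAt z î c

  Slice-insertAt : ∀ {c u} → Counts α α 1 (c ∷ u) → Slice c (insertAt î c u)
  Slice-insertAt {c} {u} cu =
    Counts⇒Vertex₃ (Counts-insertAt î u cu) ,
    SymAt-insertAt î c u (subst (î ≤_) (sym (suc-injective (trans (length-Counts cu) (+-comm (α + α) 1)))) î≤)

  Slice-removeAt : ∀ {c z} → Slice c z → Counts α α 1 (c ∷ removeAt î z)
  Slice-removeAt {z = z} (vz , s) = Counts-removeAt î z s (Vertex₃⇒Counts vz)

  Slice-disjoint : ∀ {c d z} → c ≢ d → Slice c z → Slice d z → ⊥
  Slice-disjoint {z = z} c≢d (_ , s) (_ , s′) = c≢d (SymAt-functional î z s s′)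

  Vertex⇒Slice : ∀ {z} → Vertex G z → ∃ λ c → Letter c × Slice c z
  Vertex⇒Slice {z} vz with SymAt-defined î z (subst (î <_) (sym (length-Vertex vz)) (s≤s î≤))
  ... | c , s = c , All-SymAt î z (proj₁ vz) s , vz , s

  slice₃ : BijectiveHom (Vertex (α ∷ α ∷ [])) (Slice 3)
  slice₃ = record
    { to           = insertAt î 3
    ; from         = removeAt î
    ; to-Adj       = Adj-insertAt j 3
    ; to-injective = insertAt-injective î 3
    ; to-∈         = Slice-insertAt ∘ Counts-∷₃ ∘ Vertex₂⇒Counts
    ; from-∈       = Counts⇒Vertex₂ ∘ Counts-∷₃⁻ ∘ Slice-removeAt
    ; to-from      = λ (_ , s) → insertAt-removeAt î _ s
    }

  slice₂ : BijectiveHom (Vertex (α ∷ β ∷ 1 ∷ [])) (Slice 2)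
  slice₂ = record
    { to           = insertAt î 2
    ; from         = removeAt î
    ; to-Adj       = Adj-insertAt j 2
    ; to-injective = insertAt-injective î 2
    ; to-∈         = Slice-insertAt ∘ Counts-∷₂ ∘ Vertex₃⇒Counts
    ; from-∈       = Counts⇒Vertex₃ ∘ Counts-∷₂⁻ ∘ Slice-removeAt
    ; to-from      = λ (_ , s) → insertAt-removeAt î _ s
    }

  slice₁ : BijectiveHom (Vertex (α ∷ β ∷ 1 ∷ [])) (Slice 1)
  slice₁ = record
    { to           = insertAt î 1 ∘ map σ
    ; from         = map σ ∘ removeAt î
    ; to-Adj       = Adj-insertAt j 1 ∘ Adj-map σ-injective
    ; to-injective = map-injective σ-injective ∘ insertAt-injective î 1
    ; to-∈         = Slice-insertAt ∘ Counts-∷₁ ∘ Counts-map-σ ∘ Vertex₃⇒Counts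
    ; from-∈       = Counts⇒Vertex₃ ∘ Counts-map-σ ∘ Counts-∷₁⁻ ∘ Slice-removeAt
    ; to-from      = λ (_ , s) → trans (cong (insertAt î 1) (map-σ-involutive _)) (insertAt-removeAt î _ s)
    }

  SliceLaceable : ℕ → ℕ → ℕ → Set
  SliceLaceable c s t = ∀ {x y} → Slice c x → Slice c y → First x s → First y t → HamPathOn (Slice c) x y

  SliceLaceable-sym : ∀ {c s t} → SliceLaceable c s t → SliceLaceable c t s
  SliceLaceable-sym lace sx sy fx fy = HamPathOn-reverse (lace sy sx fy fx)

  data Perm : ℕ → ℕ → ℕ → Set where
    p123 : Perm 1 2 3
    p132 : Perm 1 3 2
    p213 : Perm 2 1 3
    p231 : Perm 2 3 1
    p312 : Perm 3 1 2
    p321 : Perm 3 2 1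

  Perm-swap : ∀ {P M Q} → Perm P M Q → Perm M P Q
  Perm-swap p123 = p213
  Perm-swap p132 = p312
  Perm-swap p213 = p123
  Perm-swap p231 = p321
  Perm-swap p312 = p132
  Perm-swap p321 = p231

  Perm-rotate : ∀ {P M Q} → Perm P M Q → Perm M Q P
  Perm-rotate p123 = p231
  Perm-rotate p132 = p321
  Perm-rotate p213 = p132
  Perm-rotate p231 = p312
  Perm-rotate p312 = p123
  Perm-rotate p321 = p213

  Perm-distinct : ∀ {P M Q} → Perm P M Q → P ≢ M × P ≢ Q × M ≢ Q
  Perm-distinct p123 = (λ ()) , (λ ()) , (λ ())
  Perm-distinct p132 = (λ ()) , (λ ()) , (λ ())
  Perm-distinct p213 = (λ ()) , (λ ()) , (λ ())
  Perm-distinct p231 = (λ ()) , (λ ()) , (λ ())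
  Perm-distinct p312 = (λ ()) , (λ ()) , (λ ())
  Perm-distinct p321 = (λ ()) , (λ ()) , (λ ())

  Perm-cover : ∀ {P M Q c} → Perm P M Q → Letter c → c ≡ P ⊎ c ≡ M ⊎ c ≡ Q
  Perm-cover p123 letter₁ = inj₁ refl
  Perm-cover p123 letter₂ = inj₂ (inj₁ refl)
  Perm-cover p123 letter₃ = inj₂ (inj₂ refl)
  Perm-cover p132 letter₁ = inj₁ refl
  Perm-cover p132 letter₂ = inj₂ (inj₂ refl)
  Perm-cover p132 letter₃ = inj₂ (inj₁ refl)
  Perm-cover p213 letter₁ = inj₂ (inj₁ refl)
  Perm-cover p213 letter₂ = inj₁ refl
  Perm-cover p213 letter₃ = inj₂ (inj₂ refl)
  Perm-cover p231 letter₁ = inj₂ (inj₂ refl)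
  Perm-cover p231 letter₂ = inj₁ refl
  Perm-cover p231 letter₃ = inj₂ (inj₁ refl)
  Perm-cover p312 letter₁ = inj₂ (inj₁ refl)
  Perm-cover p312 letter₂ = inj₂ (inj₂ refl)
  Perm-cover p312 letter₃ = inj₁ refl
  Perm-cover p321 letter₁ = inj₂ (inj₂ refl)
  Perm-cover p321 letter₂ = inj₂ (inj₁ refl)
  Perm-cover p321 letter₃ = inj₁ refl

  filler : ℕ → Word
  filler 1 = blocks α β 0
  filler 2 = blocks β α 0
  filler _ = blocks β β 1

  link : ℕ → ℕ → ℕ → Word
  link P M Q = insertAt î P (M ∷ filler Q)

  Counts-link : ∀ {P M Q} → Perm P M Q → Counts α α 1 (P ∷ M ∷ filler Q)
  Counts-link p123 = Counts-∷₁ (Counts-∷₂ (Counts-blocks β β 1))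
  Counts-link p132 = Counts-∷₁ (Counts-∷₃ (Counts-blocks β α 0))
  Counts-link p213 = Counts-∷₂ (Counts-∷₁ (Counts-blocks β β 1))
  Counts-link p231 = Counts-∷₂ (Counts-∷₃ (Counts-blocks α β 0))
  Counts-link p312 = Counts-∷₃ (Counts-∷₁ (Counts-blocks β α 0))
  Counts-link p321 = Counts-∷₃ (Counts-∷₂ (Counts-blocks α β 0))

  link-Slice : ∀ {P M Q} → Perm P M Q → Slice P (link P M Q)
  link-Slice = Slice-insertAt ∘ Counts-link

  link-Adj : ∀ {P M Q} → Perm P M Q → Adj (link P M Q) (link M P Q)
  link-Adj {Q = Q} π = Adj-swap j (filler Q) (≢-sym (proj₁ (Perm-distinct π)))

  Vertex⇒Slices : ∀ {P M Q z} → Perm P M Q → Vertex G z → Slice P z ⊎ Slice M z ⊎ Slice Q z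
  Vertex⇒Slices π vz with Vertex⇒Slice vz
  ... | c , lc , sz with Perm-cover π lc
  ... | inj₁ refl = inj₁ sz
  ... | inj₂ (inj₁ refl) = inj₂ (inj₁ sz)
  ... | inj₂ (inj₂ refl) = inj₂ (inj₂ sz)

  hamPath-via : ∀ {P M Q s t x y} → Perm P M Q →
    SliceLaceable P s M → SliceLaceable M P Q → SliceLaceable Q M t →
    Slice P x → Slice Q y → First x s → First y t → HamPath G x y
  hamPath-via {P} {M} {Q} {x = x} {y} π lace-P lace-M lace-Q px qy fx fy
    with P≢M , P≢Q , M≢Q ← Perm-distinct π =
    HamPathOn-resp [ proj₁ , [ proj₁ , proj₁ ] ] (Vertex⇒Slices π)
      (HamPathOn-++ (λ sz → [ Slice-disjoint P≢M sz , Slice-disjoint P≢Q sz ]′) path-P (link-Adj π)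
        (HamPathOn-++ (Slice-disjoint M≢Q) path-M (link-Adj (Perm-rotate π)) path-Q))
    where
    path-P : HamPathOn (Slice P) x (link P M Q)
    path-P = lace-P px (link-Slice π) fx refl

    path-M : HamPathOn (Slice M) (link M P Q) (link M Q P)
    path-M = lace-M (link-Slice (Perm-swap π)) (link-Slice (Perm-rotate π)) refl refl

    path-Q : HamPathOn (Slice Q) (link Q M P) y
    path-Q = lace-Q (link-Slice (Perm-swap (Perm-rotate π))) qy refl fy

  module _ (lace₃ : HamLaceable (α ∷ α ∷ [])) (lace₁ : Ham1Laceable (α ∷ β ∷ 1 ∷ [])) where

    slice₃-laceable : ∀ {s t} → s ≢ t → SliceLaceable 3 s t
    slice₃-laceable s≢t sx sy fx fy = HamPathOn-lift slice₃ sx sy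
      (lace₃ _ _ _ _ (from-∈ sx) (from-∈ sy) (First-removeAt j fx) (First-removeAt j fy) s≢t)
      where open BijectiveHom slice₃

    slice₂-laceable : ∀ {t} → t ≢ 1 → SliceLaceable 2 1 t
    slice₂-laceable t≢1 sx sy fx fy = HamPathOn-lift slice₂ sx sy
      (lace₁ _ _ _ (from-∈ sx) (from-∈ sy) (First-removeAt j fx) (First-removeAt j fy) t≢1)
      where open BijectiveHom slice₂

    slice₁-laceable : ∀ {t} → t ≢ 2 → SliceLaceable 1 2 t
    slice₁-laceable t≢2 sx sy fx fy = HamPathOn-lift slice₁ sx sy
      (lace₁ _ _ _ (from-∈ sx) (from-∈ sy) (First-map σ (First-removeAt j fx)) (First-map σ (First-removeAt j fy))
        (t≢2 ∘ σ-injective))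
      where open BijectiveHom slice₁

    hamPath-x∈slice₃ : ∀ {s t x y} → s ≡ 1 ⊎ s ≡ 2 → t ≢ σ s →
      Slice 3 x → Slice s y → First x s → First y t → HamPath G x y
    hamPath-x∈slice₃ (inj₁ refl) t≢2 = hamPath-via p321
      (slice₃-laceable λ ()) (SliceLaceable-sym (slice₂-laceable λ ())) (slice₁-laceable t≢2)
    hamPath-x∈slice₃ (inj₂ refl) t≢1 = hamPath-via p312
      (slice₃-laceable λ ()) (SliceLaceable-sym (slice₁-laceable λ ())) (slice₂-laceable t≢1)

    hamPath-x∈slice-σ : ∀ {s x y} → s ≡ 1 ⊎ s ≡ 2 →
      Slice (σ s) x → Slice s y → First x s → First y (σ s) → HamPath G x y
    hamPath-x∈slice-σ (inj₁ refl) = hamPath-via p231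
      (slice₂-laceable λ ()) (slice₃-laceable λ ()) (SliceLaceable-sym (slice₁-laceable λ ()))
    hamPath-x∈slice-σ (inj₂ refl) = hamPath-via p132
      (slice₁-laceable λ ()) (slice₃-laceable λ ()) (SliceLaceable-sym (slice₂-laceable λ ()))

    InL12-at : ∀ {ℓ s t x y} → ℓ ≡ 3 ⊎ ℓ ≡ 4 → s ≡ 1 ⊎ s ≡ 2 → t ≡ 1 ⊎ t ≡ 2 ⊎ t ≡ ℓ →
      Vertex G x → Vertex G y → First x s → First y t → SymAt x î (pℓ ℓ s t) → SymAt y î s →
      HamPath G x y
    InL12-at {x = x} ℓ∈ s∈ t∈ vx vy fx fy px py
      with pℓ-cases ℓ∈ s∈ t∈ (All-SymAt î x (proj₁ vx) px) (All-First (proj₁ vy) fy)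
    ... | inj₁ (p≡3 , t≢σs) = hamPath-x∈slice₃ s∈ t≢σs (vx , subst (SymAt x î) p≡3 px) (vy , py) fx fy
    ... | inj₂ (p≡σs , refl) = hamPath-x∈slice-σ s∈ (vx , subst (SymAt x î) p≡σs px) (vy , py) fx fy

lemma21 : (α : ℕ) → 3 ≤ α →
    HamLaceable (α ∷ α ∷ []) →
    Ham1Laceable (α ∷ (α ∸ 1) ∷ 1 ∷ []) →
    InL12 (α ∷ α ∷ 1 ∷ [])
-- The clauses for α = 0 and for witness position 0 are absurd and left to Agda.
lemma21 (suc β) _ lace₃ lace₁ ℓ ℓ∈ x y s t vx vy _ fx s∈ fy t∈ (suc j , _ , px , py) =
  Slicing.InL12-at β j (index-bound vx px) lace₃ lace₁ ℓ∈ s∈ t∈ vx vy fx fy px py
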